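{- Let $n\ge t\ge 4$ and $X=\{1,2,\ldots,n\}$. Let $s(n,t)$ denote the smallest number $s$ such that every family $\mathcal{F}\subset 2^X$ with $|\mathcal{F}|\ge s$ is $t$-separable. Then $$\left(\frac{n}{t-1}\right)^{t-1}<s(n,t)\le g(n,t-1)+1+\sum_{i=0}^{t-2}\binom{n}{i}.$$
   Context: A family $\mathcal{F}\subset 2^X$ is called $t$-separable if there is a $t$-element subset $T\subset X$ such that for every ordered pair $x,y\in T$ with $x\neq y$ there exists $F\in\mathcal{F}$ with $F\cap\{x,y\}=\{x\}$. For $k\ge 2$, a $k$-graph on $X$ is a family of $k$-element subsets of $X$. A generalized triangle (of $k$-sets) consists of three distinct $k$-element sets $E_1,E_2,E_3$ with $|E_1\cap E_2|=k-1$ and $E_3\supseteq (E_1\setminus E_2)\cup(E_2\setminus E_1)$. $g(n,k)$ denotes the maximum number of edges of a $k$-graph on an $n$-element set that contains no generalized triangle. -}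

module Defs where

open import Data.Nat using (ℕ; _+_; _*_; _∸_; _^_; _≤_; _<_)
open import Data.Nat.Combinatorics using (_C_)
open import Data.Fin using (Fin)
open import Data.Fin.Subset using (Subset; _∈_; _∉_; _∩_; _⊇_; _─_; _∪_; ∣_∣)
open import Data.List using (List; length; map; upTo)
open import Data.Nat.ListAction using (sum)
open import Data.Empty using (⊥)
open import Data.List.Relation.Unary.All using (All)
open import Data.List.Relation.Unary.Unique.Propositional using (Unique)
import Data.List.Membership.Propositional as L
open import Data.Product using (Σ; ∃; _×_)
open import Relation.Binary.PropositionalEquality using (_≡_; _≢_)

-- A family 𝓕 ⊆ 2^X with X = Fin n is a duplicate-free list of subsets;
-- its cardinality |𝓕| is the length of the list.
record Family (n : ℕ) : Set where
  constructor family
  field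
    sets     : List (Subset n)
    distinct : Unique sets
open Family public

size : ∀ {n} → Family n → ℕ
size 𝓕 = length (sets 𝓕)

-- t-separable: some t-element T ⊆ X such that for all ordered pairs x ≠ y in T
-- some F ∈ 𝓕 has F ∩ {x,y} = {x}, i.e. x ∈ F and y ∉ F.
Separable : ∀ {n} → ℕ → Family n → Set
Separable {n} t 𝓕 =
  Σ (Subset n) λ T → ∣ T ∣ ≡ t ×
    (∀ (x y : Fin n) → x ∈ T → y ∈ T → x ≢ y →
       Σ (Subset n) λ F → F L.∈ sets 𝓕 × x ∈ F × y ∉ F)

IsS : ℕ → ℕ → ℕ → Set
IsS n t s =
  (∀ (𝓕 : Family n) → s ≤ size 𝓕 → Separable t 𝓕) ×
  (∀ s′ → (∀ (𝓕 : Family n) → s′ ≤ size 𝓕 → Separable t 𝓕) → s ≤ s′)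

IsKGraph : ∀ {n} → ℕ → Family n → Set
IsKGraph k 𝓗 = All (λ E → ∣ E ∣ ≡ k) (sets 𝓗)

HasGenTriangle : ∀ {n} → ℕ → Family n → Set
HasGenTriangle {n} k 𝓗 =
  Σ (Subset n) λ E₁ → Σ (Subset n) λ E₂ → Σ (Subset n) λ E₃ →
    E₁ L.∈ sets 𝓗 × E₂ L.∈ sets 𝓗 × E₃ L.∈ sets 𝓗 ×
    E₁ ≢ E₂ × E₁ ≢ E₃ × E₂ ≢ E₃ ×
    ∣ E₁ ∩ E₂ ∣ ≡ k ∸ 1 ×
    E₃ ⊇ ((E₁ ─ E₂) ∪ (E₂ ─ E₁))

TriangleFree : ∀ {n} → ℕ → Family n → Set
TriangleFree k 𝓗 = IsKGraph k 𝓗 × (HasGenTriangle k 𝓗 → ⊥)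

IsG : ℕ → ℕ → ℕ → Set
IsG n k g =
  (Σ (Family n) λ 𝓗 → TriangleFree k 𝓗 × size 𝓗 ≡ g) ×
  (∀ (𝓗 : Family n) → TriangleFree k 𝓗 → size 𝓗 ≤ g)

binomSum : ℕ → ℕ → ℕ
binomSum n m = sum (map (n C_) (upTo m))

-- Upper bound: by Pajor's lemma 𝓕 shatters at least |𝓕| sets, and a shattered set is
-- separated by 𝓕. If none of them has t elements, at most ∑_{i<t−1} C(n,i) of them have
-- fewer than t − 1, and those with exactly t − 1 form a (t−1)-graph. If that graph contains
-- a generalized triangle E₁, E₂, E₃, then E₁ ∪ E₂ is a separated t-set, since a pair lying
-- in neither E₁ nor E₂ lies in E₁ Δ E₂ ⊆ E₃; otherwise it has at most g(n,t−1) edges.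
-- Lower bound: cut X into t − 1 blocks of sizes aᵢ with n ≤ (t − 1)(aᵢ + 1) and take all
-- unions of one initial segment of each block. These ∏(aᵢ + 1) ≥ (n/(t−1))^(t−1) sets
-- separate at most one point per block, so they are not t-separable.
module Submission where

open import Defs
open import Data.Bool using (Bool; true; false; _∧_)
import Data.Bool as Bool
open import Data.Bool.Properties using (∧-zeroʳ)
open import Data.Empty using (⊥-elim)
open import Data.Fin using (Fin; zero; suc; _↑ˡ_; _↑ʳ_)
open import Data.Fin.Properties using (↑ˡ-injective; ↑ʳ-injective)
import Data.Fin.Properties as Finₚ
open import Data.Fin.Subset using (Subset; _∈_; _∉_; _∩_; _∪_; _─_; _⊆_; _⊇_; ∣_∣; ⁅_⁆; ⊥; Empty)
open import Data.Fin.Subset.Properties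
  using (x∈⁅x⁆; x∈⁅y⁆⇒x≡y; x∈p∩q⁺; x∈p∩q⁻; x∈p∪q⁺; x∈p∪q⁻; x∈p∧x∉q⇒x∈p─q; ∉⊥; ∣⊥∣≡0; Empty-unique; _⊆?_)
import Data.Fin.Subset.Properties as Subsetₚ
open import Data.List
  using (List; []; _∷_; length; map; filter; _++_; upTo; _∷ʳ_; replicate; cartesianProductWith)
open import Data.List.Properties using (length-++; length-map; upTo-∷ʳ; map-++; length-replicate)
open import Data.List.Relation.Unary.Any using (here; there; any?)
open import Data.List.Relation.Unary.All as All using (All; []; _∷_)
open import Data.List.Relation.Unary.All.Properties as Allₚ using (¬Any⇒All¬; all-filter; replicate⁺)
open import Data.List.Relation.Unary.AllPairs using ([]; _∷_)
open import Data.List.Relation.Unary.Unique.Propositional using (Unique)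
import Data.List.Relation.Unary.Unique.Propositional.Properties as Uniqueₚ
import Data.List.Membership.Propositional as L
open import Data.List.Membership.Propositional using (find; lose)
open import Data.List.Membership.Propositional.Properties
  using (∈-filter⁻; ∈-++⁻; ∈-map⁻; ∈-cartesianProductWith⁻)
import Data.List.Membership.DecPropositional as DecMembership
open import Data.Nat using (ℕ; zero; suc; _+_; _*_; _∸_; _^_; _≤_; _<_; z≤n; s≤s; _≤?_)
import Data.Nat as ℕ
open import Data.Nat.Properties
open import Data.Nat.Combinatorics using (_C_; nCk+nC[k+1]≡[n+1]C[k+1])
open import Data.Nat.DivMod using (_/_; _%_; m/n*n≤m; m%n<n; m≡m%n+[m/n]*n)
open import Data.Nat.ListAction using (sum; product)
open import Data.Nat.ListAction.Properties using (sum-++)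
open import Data.Nat.Solver using (module +-*-Solver)
open import Data.Product using (∃; _×_; _,_; proj₁; proj₂)
open import Data.Sum using (_⊎_; inj₁; inj₂)
open import Data.Vec using ([]; _∷_; here; there; splitAt)
import Data.Vec as Vec
open import Data.Vec.Properties using (≡-dec; ∷-injectiveʳ; ++-injective)
open import Function using (_∘_)
open import Relation.Nullary using (¬_; Dec; yes; no; ¬?)
open import Relation.Nullary.Decidable using (_×-dec_; map′)
open import Relation.Unary.Properties using (∁?)
open import Relation.Binary.Definitions using (DecidableEquality)
open import Relation.Binary.PropositionalEquality
  using (_≡_; _≢_; refl; sym; trans; cong; cong₂; subst; module ≡-Reasoning)

SeparatesPair : ∀ {n} → List (Subset n) → Fin n → Fin n → Set
SeparatesPair 𝓕 x y = ∃ λ G → G L.∈ 𝓕 × x ∈ G × y ∉ G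

Separates : ∀ {n} → List (Subset n) → Subset n → Set
Separates {n} 𝓕 T = ∀ (x y : Fin n) → x ∈ T → y ∈ T → x ≢ y → SeparatesPair 𝓕 x y

Shattered : ∀ {n} → List (Subset n) → Subset n → Set
Shattered {n} 𝓕 S = ∀ (A : Subset n) → ∃ λ G → G L.∈ 𝓕 × G ∩ S ≡ A ∩ S

shattered⇒separates : ∀ {n} {𝓕 : List (Subset n)} {S} → Shattered 𝓕 S → Separates 𝓕 S
shattered⇒separates {S = S} sh x y x∈S y∈S x≢y =
  let G , G∈𝓕 , G∩S≡⁅x⁆∩S = sh ⁅ x ⁆
      x∈G∩S = subst (x ∈_) (sym G∩S≡⁅x⁆∩S) (x∈p∩q⁺ (x∈⁅x⁆ x , x∈S))
      y∉G y∈G = x≢y (sym (x∈⁅y⁆⇒x≡y x (proj₁ (x∈p∩q⁻ ⁅ x ⁆ S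
                  (subst (y ∈_) G∩S≡⁅x⁆∩S (x∈p∩q⁺ (y∈G , y∈S)))))))
  in G , G∈𝓕 , proj₁ (x∈p∩q⁻ G S x∈G∩S) , y∉G

separates-⊆ : ∀ {n} {𝓕 : List (Subset n)} {S T} → T ⊆ S → Separates 𝓕 S → Separates 𝓕 T
separates-⊆ T⊆S sep x y x∈T y∈T = sep x y (T⊆S x∈T) (T⊆S y∈T)

-- Pajor's lemma

fibre : ∀ {n} → Bool → List (Subset (suc n)) → List (Subset n)
fibre b [] = []
fibre b ((c ∷ v) ∷ 𝓕) with b Bool.≟ c
... | yes _ = v ∷ fibre b 𝓕
... | no _ = fibre b 𝓕

∈-fibre⁻ : ∀ {n} b (𝓕 : List (Subset (suc n))) {v} → v L.∈ fibre b 𝓕 → (b ∷ v) L.∈ 𝓕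
∈-fibre⁻ b ((c ∷ w) ∷ 𝓕) v∈ with b Bool.≟ c | v∈
... | yes refl | here refl = here refl
... | yes refl | there v∈′ = there (∈-fibre⁻ b 𝓕 v∈′)
... | no _ | v∈′ = there (∈-fibre⁻ b 𝓕 v∈′)

all-fibre : ∀ {n} {P : Subset (suc n) → Set} b {𝓕} → All P 𝓕 → All (λ v → P (b ∷ v)) (fibre b 𝓕)
all-fibre b [] = []
all-fibre b {(c ∷ w) ∷ 𝓕} (p ∷ ps) with b Bool.≟ c
... | yes refl = p ∷ all-fibre b ps
... | no _ = all-fibre b ps

unique-fibre : ∀ {n} b {𝓕 : List (Subset (suc n))} → Unique 𝓕 → Unique (fibre b 𝓕)
unique-fibre b [] = []
unique-fibre b {(c ∷ w) ∷ 𝓕} (w∉𝓕 ∷ u) with b Bool.≟ c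
... | yes refl = All.map (λ ne eq → ne (cong (b ∷_) eq)) (all-fibre b w∉𝓕) ∷ unique-fibre b u
... | no _ = unique-fibre b u

length-fibres : ∀ {n} (𝓕 : List (Subset (suc n))) →
  length 𝓕 ≡ length (fibre false 𝓕) + length (fibre true 𝓕)
length-fibres [] = refl
length-fibres ((false ∷ v) ∷ 𝓕) = cong suc (length-fibres 𝓕)
length-fibres ((true ∷ v) ∷ 𝓕) = trans (cong suc (length-fibres 𝓕)) (sym (+-suc _ _))

join : ∀ {n} → List (Subset n) → List (Subset n) → List (Subset (suc n))
join 𝓐 𝓑 = map (false ∷_) 𝓐 ++ map (true ∷_) 𝓑

length-join : ∀ {n} (𝓐 𝓑 : List (Subset n)) → length (join 𝓐 𝓑) ≡ length 𝓐 + length 𝓑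
length-join 𝓐 𝓑 =
  trans (length-++ (map (false ∷_) 𝓐)) (cong₂ _+_ (length-map (false ∷_) 𝓐) (length-map (true ∷_) 𝓑))

unique-join : ∀ {n} {𝓐 𝓑 : List (Subset n)} → Unique 𝓐 → Unique 𝓑 → Unique (join 𝓐 𝓑)
unique-join u v = Uniqueₚ.++⁺ (Uniqueₚ.map⁺ ∷-injectiveʳ u) (Uniqueₚ.map⁺ ∷-injectiveʳ v) heads-differ
  where
  heads-differ : ∀ {n} {𝓐 𝓑 : List (Subset n)} {w} → ¬ (w L.∈ map (false ∷_) 𝓐 × w L.∈ map (true ∷_) 𝓑)
  heads-differ (w∈₀ , w∈₁) with ∈-map⁻ (false ∷_) w∈₀ | ∈-map⁻ (true ∷_) w∈₁
  ... | _ , _ , refl | _ , _ , ()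

_≟ˢ_ : ∀ {n} → DecidableEquality (Subset n)
_≟ˢ_ = ≡-dec Bool._≟_

_∈ˡ?_ : ∀ {n} (v : Subset n) (𝓕 : List (Subset n)) → Dec (v L.∈ 𝓕)
_∈ˡ?_ = DecMembership._∈?_ _≟ˢ_

_∪ˡ_ : ∀ {n} → List (Subset n) → List (Subset n) → List (Subset n)
𝓐 ∪ˡ 𝓑 = 𝓐 ++ filter (∁? (_∈ˡ? 𝓐)) 𝓑

_∩ˡ_ : ∀ {n} → List (Subset n) → List (Subset n) → List (Subset n)
𝓐 ∩ˡ 𝓑 = filter (_∈ˡ? 𝓐) 𝓑

length-filter+filter∁ : ∀ {A : Set} {P : A → Set} (P? : ∀ x → Dec (P x)) xs →
  length (filter P? xs) + length (filter (∁? P?) xs) ≡ length xs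
length-filter+filter∁ P? [] = refl
length-filter+filter∁ P? (x ∷ xs) with P? x
... | yes _ = cong suc (length-filter+filter∁ P? xs)
... | no _ = trans (+-suc _ _) (cong suc (length-filter+filter∁ P? xs))

length-∪ˡ+∩ˡ : ∀ {n} (𝓐 𝓑 : List (Subset n)) →
  length (𝓐 ∪ˡ 𝓑) + length (𝓐 ∩ˡ 𝓑) ≡ length 𝓐 + length 𝓑
length-∪ˡ+∩ˡ 𝓐 𝓑 = begin
  length (𝓐 ∪ˡ 𝓑) + length (𝓐 ∩ˡ 𝓑)       ≡⟨ cong (_+ length (𝓐 ∩ˡ 𝓑)) (length-++ 𝓐) ⟩
  length 𝓐 + length outside + length inside ≡⟨ +-assoc (length 𝓐) _ _ ⟩
  length 𝓐 + (length outside + length inside) ≡⟨ cong (length 𝓐 +_) (+-comm (length outside) _) ⟩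
  length 𝓐 + (length inside + length outside) ≡⟨ cong (length 𝓐 +_) (length-filter+filter∁ (_∈ˡ? 𝓐) 𝓑) ⟩
  length 𝓐 + length 𝓑                       ∎
  where
  open ≡-Reasoning
  inside outside : List (Subset _)
  inside = filter (_∈ˡ? 𝓐) 𝓑
  outside = filter (∁? (_∈ˡ? 𝓐)) 𝓑

unique-∪ˡ : ∀ {n} {𝓐 𝓑 : List (Subset n)} → Unique 𝓐 → Unique 𝓑 → Unique (𝓐 ∪ˡ 𝓑)
unique-∪ˡ {𝓐 = 𝓐} {𝓑} u v = Uniqueₚ.++⁺ u (Uniqueₚ.filter⁺ _ v)
  λ (w∈𝓐 , w∈rest) → proj₂ (∈-filter⁻ (∁? (_∈ˡ? 𝓐)) {xs = 𝓑} w∈rest) w∈𝓐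

unique-∩ˡ : ∀ {n} {𝓐 𝓑 : List (Subset n)} → Unique 𝓑 → Unique (𝓐 ∩ˡ 𝓑)
unique-∩ˡ {𝓐 = 𝓐} = Uniqueₚ.filter⁺ (_∈ˡ? 𝓐)

∈-∪ˡ⁻ : ∀ {n} (𝓐 𝓑 : List (Subset n)) {v} → v L.∈ 𝓐 ∪ˡ 𝓑 → v L.∈ 𝓐 ⊎ v L.∈ 𝓑
∈-∪ˡ⁻ 𝓐 𝓑 v∈ with ∈-++⁻ 𝓐 v∈
... | inj₁ v∈𝓐 = inj₁ v∈𝓐
... | inj₂ v∈rest = inj₂ (proj₁ (∈-filter⁻ (∁? (_∈ˡ? 𝓐)) {xs = 𝓑} v∈rest))

∈-∩ˡ⁻ : ∀ {n} (𝓐 𝓑 : List (Subset n)) {v} → v L.∈ 𝓐 ∩ˡ 𝓑 → v L.∈ 𝓐 × v L.∈ 𝓑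
∈-∩ˡ⁻ 𝓐 𝓑 v∈ = let v∈𝓑 , v∈𝓐 = ∈-filter⁻ (_∈ˡ? 𝓐) {xs = 𝓑} v∈ in v∈𝓐 , v∈𝓑

-- A trace on S of a member of one fibre extends by that fibre's bit to a trace of 𝓕 on
-- false ∷ S; a trace of a member of both fibres extends by either bit, hence to true ∷ S.
shattered-false : ∀ {n} (𝓕 : List (Subset (suc n))) {S} →
  Shattered (fibre false 𝓕 ∪ˡ fibre true 𝓕) S → Shattered 𝓕 (false ∷ S)
shattered-false 𝓕 sh (a ∷ A) with sh A
... | G , G∈ , G∩S≡A∩S with ∈-∪ˡ⁻ (fibre false 𝓕) (fibre true 𝓕) G∈
...   | inj₁ G∈₀ = false ∷ G , ∈-fibre⁻ false 𝓕 G∈₀ , cong₂ _∷_ (sym (∧-zeroʳ a)) G∩S≡A∩S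
...   | inj₂ G∈₁ = true ∷ G , ∈-fibre⁻ true 𝓕 G∈₁ , cong₂ _∷_ (sym (∧-zeroʳ a)) G∩S≡A∩S

shattered-true : ∀ {n} (𝓕 : List (Subset (suc n))) {S} →
  Shattered (fibre false 𝓕 ∩ˡ fibre true 𝓕) S → Shattered 𝓕 (true ∷ S)
shattered-true 𝓕 sh (a ∷ A) with sh A
... | G , G∈ , G∩S≡A∩S = a ∷ G , ∈-fibre⁻ a 𝓕 (in-fibre a) , cong (a ∧ true ∷_) G∩S≡A∩S
  where
  in-fibre : ∀ b → G L.∈ fibre b 𝓕
  in-fibre false = proj₁ (∈-∩ˡ⁻ (fibre false 𝓕) (fibre true 𝓕) G∈)
  in-fibre true = proj₂ (∈-∩ˡ⁻ (fibre false 𝓕) (fibre true 𝓕) G∈)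

ManyShatteredSets : ∀ {n} → List (Subset n) → Set
ManyShatteredSets 𝓕 = ∃ λ 𝓢 → Unique 𝓢 × All (Shattered 𝓕) 𝓢 × length 𝓕 ≤ length 𝓢

manyShatteredSets-step : ∀ {n} (𝓕 : List (Subset (suc n))) →
  ManyShatteredSets (fibre false 𝓕 ∪ˡ fibre true 𝓕) →
  ManyShatteredSets (fibre false 𝓕 ∩ˡ fibre true 𝓕) → ManyShatteredSets 𝓕
manyShatteredSets-step 𝓕 (𝓢₀ , u₀ , sh₀ , ≤₀) (𝓢₁ , u₁ , sh₁ , ≤₁) =
  join 𝓢₀ 𝓢₁ ,
  unique-join u₀ u₁ ,
  Allₚ.++⁺ (Allₚ.map⁺ (All.map (shattered-false 𝓕) sh₀)) (Allₚ.map⁺ (All.map (shattered-true 𝓕) sh₁)) ,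
  (begin
    length 𝓕                                   ≡⟨ length-fibres 𝓕 ⟩
    length 𝓕₀ + length 𝓕₁                      ≡⟨ length-∪ˡ+∩ˡ 𝓕₀ 𝓕₁ ⟨
    length (𝓕₀ ∪ˡ 𝓕₁) + length (𝓕₀ ∩ˡ 𝓕₁)     ≤⟨ +-mono-≤ ≤₀ ≤₁ ⟩
    length 𝓢₀ + length 𝓢₁                      ≡⟨ length-join 𝓢₀ 𝓢₁ ⟨
    length (join 𝓢₀ 𝓢₁)                        ∎)
  where
  open ≤-Reasoning
  𝓕₀ 𝓕₁ : List (Subset _)
  𝓕₀ = fibre false 𝓕
  𝓕₁ = fibre true 𝓕

pajor : ∀ {n} (𝓕 : List (Subset n)) → Unique 𝓕 → ManyShatteredSets 𝓕
pajor {zero} [] _ = [] , [] , [] , z≤n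
pajor {zero} ([] ∷ []) _ = [] ∷ [] , [] ∷ [] , (λ { [] → [] , here refl , refl }) ∷ [] , ≤-refl
pajor {zero} ([] ∷ [] ∷ _) ((≢[] ∷ _) ∷ _) = ⊥-elim (≢[] refl)
pajor {suc n} 𝓕 u =
  manyShatteredSets-step 𝓕
    (pajor _ (unique-∪ˡ (unique-fibre false u) (unique-fibre true u)))
    (pajor _ (unique-∩ˡ (unique-fibre true u)))

binomSum-suc : ∀ n m → binomSum n (suc m) ≡ binomSum n m + n C m
binomSum-suc n m = begin
  sum (map (n C_) (upTo (suc m)))           ≡⟨ cong (sum ∘ map (n C_)) (upTo-∷ʳ m) ⟨
  sum (map (n C_) (upTo m ∷ʳ m))            ≡⟨ cong sum (map-++ (n C_) (upTo m) (m ∷ [])) ⟩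
  sum (map (n C_) (upTo m) ++ (n C m ∷ []))  ≡⟨ sum-++ (map (n C_) (upTo m)) (n C m ∷ []) ⟩
  binomSum n m + (n C m + 0)                ≡⟨ cong (binomSum n m +_) (+-identityʳ _) ⟩
  binomSum n m + n C m                      ∎
  where open ≡-Reasoning

binomSum-pascal : ∀ n m → binomSum (suc n) (suc m) ≡ binomSum n (suc m) + binomSum n m
binomSum-pascal n zero = refl
binomSum-pascal n (suc m) = begin
  binomSum (suc n) (suc (suc m))                        ≡⟨ binomSum-suc (suc n) (suc m) ⟩
  binomSum (suc n) (suc m) + suc n C suc m
    ≡⟨ cong₂ _+_ (binomSum-pascal n m) (sym (nCk+nC[k+1]≡[n+1]C[k+1] n m)) ⟩
  (binomSum n (suc m) + binomSum n m) + (n C m + n C suc m)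
    ≡⟨ solve 4 (λ a b c d → (a :+ b) :+ (c :+ d) := (a :+ d) :+ (b :+ c)) refl
         (binomSum n (suc m)) (binomSum n m) (n C m) (n C suc m) ⟩
  (binomSum n (suc m) + n C suc m) + (binomSum n m + n C m)
    ≡⟨ cong₂ _+_ (binomSum-suc n (suc m)) (binomSum-suc n m) ⟨
  binomSum n (suc (suc m)) + binomSum n (suc m)         ∎
  where
  open ≡-Reasoning
  open +-*-Solver

0<binomSum : ∀ n m → 0 < binomSum n (suc m)
0<binomSum n zero = s≤s z≤n
0<binomSum n (suc m) =
  ≤-trans (0<binomSum n m) (≤-trans (m≤m+n _ _) (≤-reflexive (sym (binomSum-suc n (suc m)))))

length≤binomSum : ∀ n m {𝓕 : List (Subset n)} → Unique 𝓕 → All (λ S → ∣ S ∣ < m) 𝓕 →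
  length 𝓕 ≤ binomSum n m
length≤binomSum n zero {[]} _ _ = z≤n
length≤binomSum n zero {_ ∷ _} _ (() ∷ _)
length≤binomSum zero (suc m) {[]} _ _ = z≤n
length≤binomSum zero (suc m) {[] ∷ []} _ _ = 0<binomSum 0 m
length≤binomSum zero (suc m) {[] ∷ [] ∷ _} ((≢[] ∷ _) ∷ _) _ = ⊥-elim (≢[] refl)
length≤binomSum (suc n) (suc m) {𝓕} u small = begin
  length 𝓕                                         ≡⟨ length-fibres 𝓕 ⟩
  length (fibre false 𝓕) + length (fibre true 𝓕)
    ≤⟨ +-mono-≤ (length≤binomSum n (suc m) (unique-fibre false u) (all-fibre false small))
                (length≤binomSum n m (unique-fibre true u) (All.map ≤-pred (all-fibre true small))) ⟩
  binomSum n (suc m) + binomSum n m                ≡⟨ binomSum-pascal n m ⟨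
  binomSum (suc n) (suc m)                         ∎
  where open ≤-Reasoning

-- Generalized triangles of shattered sets

∣p∪q∣+∣p∩q∣≡∣p∣+∣q∣ : ∀ {n} (p q : Subset n) → ∣ p ∪ q ∣ + ∣ p ∩ q ∣ ≡ ∣ p ∣ + ∣ q ∣
∣p∪q∣+∣p∩q∣≡∣p∣+∣q∣ [] [] = refl
∣p∪q∣+∣p∩q∣≡∣p∣+∣q∣ (true ∷ p) (true ∷ q) =
  cong suc (trans (+-suc _ _) (trans (cong suc (∣p∪q∣+∣p∩q∣≡∣p∣+∣q∣ p q)) (sym (+-suc _ _))))
∣p∪q∣+∣p∩q∣≡∣p∣+∣q∣ (true ∷ p) (false ∷ q) = cong suc (∣p∪q∣+∣p∩q∣≡∣p∣+∣q∣ p q)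
∣p∪q∣+∣p∩q∣≡∣p∣+∣q∣ (false ∷ p) (true ∷ q) = trans (cong suc (∣p∪q∣+∣p∩q∣≡∣p∣+∣q∣ p q)) (sym (+-suc _ _))
∣p∪q∣+∣p∩q∣≡∣p∣+∣q∣ (false ∷ p) (false ∷ q) = ∣p∪q∣+∣p∩q∣≡∣p∣+∣q∣ p q

separatesPair-cross : ∀ {n} {𝓕 : List (Subset n)} {E₁ E₂ E₃} →
  Shattered 𝓕 E₁ → Shattered 𝓕 E₂ → Shattered 𝓕 E₃ → E₁ ─ E₂ ⊆ E₃ → E₂ ─ E₁ ⊆ E₃ →
  ∀ {x y} → x ∈ E₁ → y ∈ E₂ → x ≢ y → SeparatesPair 𝓕 x y
separatesPair-cross {E₁ = E₁} {E₂} sh₁ sh₂ sh₃ E₁─E₂⊆E₃ E₂─E₁⊆E₃ {x} {y} x∈E₁ y∈E₂ x≢y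
  with x Subsetₚ.∈? E₂ | y Subsetₚ.∈? E₁
... | yes x∈E₂ | _ = shattered⇒separates sh₂ x y x∈E₂ y∈E₂ x≢y
... | no _ | yes y∈E₁ = shattered⇒separates sh₁ x y x∈E₁ y∈E₁ x≢y
... | no x∉E₂ | no y∉E₁ =
  shattered⇒separates sh₃ x y
    (E₁─E₂⊆E₃ (x∈p∧x∉q⇒x∈p─q x∈E₁ x∉E₂)) (E₂─E₁⊆E₃ (x∈p∧x∉q⇒x∈p─q y∈E₂ y∉E₁)) x≢y

triangle⇒separates : ∀ {n} {𝓕 : List (Subset n)} {E₁ E₂ E₃} →
  Shattered 𝓕 E₁ → Shattered 𝓕 E₂ → Shattered 𝓕 E₃ → E₃ ⊇ ((E₁ ─ E₂) ∪ (E₂ ─ E₁)) →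
  Separates 𝓕 (E₁ ∪ E₂)
triangle⇒separates {E₁ = E₁} {E₂} sh₁ sh₂ sh₃ Δ⊆E₃ x y x∈E₁∪E₂ y∈E₁∪E₂ x≢y
  with x∈p∪q⁻ E₁ E₂ x∈E₁∪E₂ | x∈p∪q⁻ E₁ E₂ y∈E₁∪E₂
... | inj₁ x∈E₁ | inj₁ y∈E₁ = shattered⇒separates sh₁ x y x∈E₁ y∈E₁ x≢y
... | inj₂ x∈E₂ | inj₂ y∈E₂ = shattered⇒separates sh₂ x y x∈E₂ y∈E₂ x≢y
... | inj₁ x∈E₁ | inj₂ y∈E₂ =
  separatesPair-cross sh₁ sh₂ sh₃ (Δ⊆E₃ ∘ x∈p∪q⁺ ∘ inj₁) (Δ⊆E₃ ∘ x∈p∪q⁺ ∘ inj₂) x∈E₁ y∈E₂ x≢y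
... | inj₂ x∈E₂ | inj₁ y∈E₁ =
  separatesPair-cross sh₂ sh₁ sh₃ (Δ⊆E₃ ∘ x∈p∪q⁺ ∘ inj₂) (Δ⊆E₃ ∘ x∈p∪q⁺ ∘ inj₁) x∈E₂ y∈E₁ x≢y

∃∈? : ∀ {A : Set} {P : A → Set} → (∀ x → Dec (P x)) → ∀ xs → Dec (∃ λ x → x L.∈ xs × P x)
∃∈? P? xs = map′ find (λ (_ , x∈ , px) → lose x∈ px) (any? P? xs)

hasGenTriangle? : ∀ {n} k (𝓗 : Family n) → Dec (HasGenTriangle k 𝓗)
hasGenTriangle? k 𝓗 =
  map′ (λ (E₁ , e₁ , E₂ , e₂ , E₃ , e₃ , rest) → E₁ , E₂ , E₃ , e₁ , e₂ , e₃ , rest)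
       (λ (E₁ , E₂ , E₃ , e₁ , e₂ , e₃ , rest) → E₁ , e₁ , E₂ , e₂ , E₃ , e₃ , rest)
    (∃∈? (λ E₁ → ∃∈? (λ E₂ → ∃∈? (λ E₃ →
       ¬? (E₁ ≟ˢ E₂) ×-dec ¬? (E₁ ≟ˢ E₃) ×-dec ¬? (E₂ ≟ˢ E₃) ×-dec
       ∣ E₁ ∩ E₂ ∣ ℕ.≟ k ∸ 1 ×-dec ((E₁ ─ E₂) ∪ (E₂ ─ E₁)) ⊆? E₃) (sets 𝓗)) (sets 𝓗)) (sets 𝓗))

-- The upper bound

⊆-ofSize : ∀ {n} (S : Subset n) k → k ≤ ∣ S ∣ → ∃ λ T → T ⊆ S × ∣ T ∣ ≡ k
⊆-ofSize [] zero _ = [] , (λ ()) , refl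
⊆-ofSize (false ∷ S) k k≤∣S∣ =
  let T , T⊆S , ∣T∣≡k = ⊆-ofSize S k k≤∣S∣
  in false ∷ T , (λ { (there x∈T) → there (T⊆S x∈T) }) , ∣T∣≡k
⊆-ofSize {suc n} (true ∷ S) zero _ = ⊥ , (⊥-elim ∘ ∉⊥) , ∣⊥∣≡0 (suc n)
⊆-ofSize (true ∷ S) (suc k) (s≤s k≤∣S∣) =
  let T , T⊆S , ∣T∣≡k = ⊆-ofSize S k k≤∣S∣
  in true ∷ T , (λ { here → here ; (there x∈T) → there (T⊆S x∈T) }) , cong suc ∣T∣≡k

shattered⇒separable : ∀ {n t} (𝓕 : Family n) {S} → Shattered (sets 𝓕) S → t ≤ ∣ S ∣ → Separable t 𝓕
shattered⇒separable 𝓕 {S} sh t≤∣S∣ =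
  let T , T⊆S , ∣T∣≡t = ⊆-ofSize S _ t≤∣S∣
  in T , ∣T∣≡t , separates-⊆ T⊆S (shattered⇒separates sh)

genTriangle⇒separable : ∀ {n k} (𝓕 𝓗 : Family n) → All (Shattered (sets 𝓕)) (sets 𝓗) →
  IsKGraph (suc k) 𝓗 → HasGenTriangle (suc k) 𝓗 → Separable (suc (suc k)) 𝓕
genTriangle⇒separable {k = k} 𝓕 𝓗 sh edges
  (E₁ , E₂ , E₃ , e₁ , e₂ , e₃ , _ , _ , _ , ∣E₁∩E₂∣≡k , Δ⊆E₃) =
  E₁ ∪ E₂ , ∣E₁∪E₂∣≡2+k ,
  triangle⇒separates (All.lookup sh e₁) (All.lookup sh e₂) (All.lookup sh e₃) Δ⊆E₃
  where
  ∣E₁∪E₂∣≡2+k : ∣ E₁ ∪ E₂ ∣ ≡ suc (suc k)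
  ∣E₁∪E₂∣≡2+k = +-cancelʳ-≡ k _ _ (begin
    ∣ E₁ ∪ E₂ ∣ + k               ≡⟨ cong (∣ E₁ ∪ E₂ ∣ +_) ∣E₁∩E₂∣≡k ⟨
    ∣ E₁ ∪ E₂ ∣ + ∣ E₁ ∩ E₂ ∣     ≡⟨ ∣p∪q∣+∣p∩q∣≡∣p∣+∣q∣ E₁ E₂ ⟩
    ∣ E₁ ∣ + ∣ E₂ ∣               ≡⟨ cong₂ _+_ (All.lookup edges e₁) (All.lookup edges e₂) ⟩
    suc k + suc k                 ≡⟨ cong suc (+-suc k k) ⟩
    suc (suc k) + k               ∎)
    where open ≡-Reasoning

layer : ∀ {n} k (𝓢 : List (Subset n)) → Unique 𝓢 → Family n
layer k 𝓢 u = family (filter (λ S → ∣ S ∣ ℕ.≟ k) 𝓢) (Uniqueₚ.filter⁺ _ u)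

length≤g+binomSum : ∀ {n k g} → IsG n (suc k) g → (𝓢 : List (Subset n)) (u : Unique 𝓢) →
  All (λ S → ∣ S ∣ ≤ suc k) 𝓢 → ¬ HasGenTriangle (suc k) (layer (suc k) 𝓢 u) →
  length 𝓢 ≤ g + binomSum n (suc k)
length≤g+binomSum {n} {k} {g} isG 𝓢 u small triangleFree = begin
  length 𝓢                            ≡⟨ length-filter+filter∁ ∣_∣≟1+k 𝓢 ⟨
  length (sets top) + length lower
    ≤⟨ +-mono-≤ (proj₂ isG top (all-filter ∣_∣≟1+k 𝓢 , triangleFree))
                (length≤binomSum n (suc k) (Uniqueₚ.filter⁺ _ u) lower-small) ⟩
  g + binomSum n (suc k)              ∎
  where
  open ≤-Reasoning
  ∣_∣≟1+k : (S : Subset n) → Dec (∣ S ∣ ≡ suc k)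
  ∣ S ∣≟1+k = ∣ S ∣ ℕ.≟ suc k
  top : Family n
  top = layer (suc k) 𝓢 u
  lower : List (Subset n)
  lower = filter (∁? ∣_∣≟1+k) 𝓢
  lower-small : All (λ S → ∣ S ∣ < suc k) lower
  lower-small = All.zipWith (λ (≤1+k , ≢1+k) → ≤∧≢⇒< ≤1+k ≢1+k)
    (Allₚ.filter⁺ (∁? ∣_∣≟1+k) small , all-filter (∁? ∣_∣≟1+k) 𝓢)

large⇒separable : ∀ {n k g} → IsG n (suc k) g → (𝓕 : Family n) →
  g + 1 + binomSum n (suc k) ≤ size 𝓕 → Separable (suc (suc k)) 𝓕
large⇒separable {n} {k} {g} isG 𝓕 large with pajor (sets 𝓕) (distinct 𝓕)
... | 𝓢 , u , shattered , size≤ with any? (λ S → suc (suc k) ≤? ∣ S ∣) 𝓢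
...   | yes big =
        let S , S∈𝓢 , 2+k≤∣S∣ = find big in shattered⇒separable 𝓕 (All.lookup shattered S∈𝓢) 2+k≤∣S∣
...   | no none with hasGenTriangle? (suc k) (layer (suc k) 𝓢 u)
...     | yes triangle =
          genTriangle⇒separable 𝓕 (layer (suc k) 𝓢 u) (Allₚ.filter⁺ _ shattered) (all-filter _ 𝓢) triangle
...     | no triangleFree = ⊥-elim (<⇒≱ g+b<g+1+b (≤-trans large (≤-trans size≤ few)))
  where
  few : length 𝓢 ≤ g + binomSum n (suc k)
  few = length≤g+binomSum isG 𝓢 u (All.map (≤-pred ∘ ≰⇒>) (¬Any⇒All¬ 𝓢 none)) triangleFree
  g+b<g+1+b : g + binomSum n (suc k) < g + 1 + binomSum n (suc k)
  g+b<g+1+b = +-monoˡ-< (binomSum n (suc k)) (m<m+n g (s≤s z≤n))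

-- The lower bound

initialSegments : ∀ m → List (Subset m)
initialSegments zero = [] ∷ []
initialSegments (suc m) = ⊥ ∷ map (true ∷_) (initialSegments m)

length-initialSegments : ∀ m → length (initialSegments m) ≡ suc m
length-initialSegments zero = refl
length-initialSegments (suc m) =
  cong suc (trans (length-map (true ∷_) (initialSegments m)) (length-initialSegments m))

unique-initialSegments : ∀ m → Unique (initialSegments m)
unique-initialSegments zero = [] ∷ []
unique-initialSegments (suc m) =
  All.tabulate (λ v∈ → ⊥≢ (∈-map⁻ (true ∷_) v∈)) ∷ Uniqueₚ.map⁺ ∷-injectiveʳ (unique-initialSegments m)
  where
  ⊥≢ : ∀ {v : Subset (suc m)} → ∃ (λ w → w L.∈ initialSegments m × v ≡ true ∷ w) → ⊥ ≢ v
  ⊥≢ (_ , _ , refl) ()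

-- Two points are never separated both ways by a chain.
separates-initialSegments : ∀ m (T : Subset m) → Separates (initialSegments m) T → ∣ T ∣ ≤ 1
separates-initialSegments zero [] _ = z≤n
separates-initialSegments (suc m) (false ∷ T) sep = separates-initialSegments m T sep′
  where
  sep′ : Separates (initialSegments m) T
  sep′ x y x∈T y∈T x≢y with sep (suc x) (suc y) (there x∈T) (there y∈T) (x≢y ∘ Finₚ.suc-injective)
  ... | _ , here refl , 1+x∈⊥ , _ = ⊥-elim (∉⊥ 1+x∈⊥)
  ... | _ , there G∈ , 1+x∈G , 1+y∉G with ∈-map⁻ (true ∷_) G∈
  ...   | G , G∈′ , refl with 1+x∈G
  ...     | there x∈G = G , G∈′ , x∈G , 1+y∉G ∘ there
separates-initialSegments (suc m) (true ∷ T) sep =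
  s≤s (≤-reflexive (trans (cong ∣_∣ (Empty-unique rest-empty)) (∣⊥∣≡0 m)))
  where
  rest-empty : Empty T
  rest-empty (y , y∈T) with sep (suc y) zero (there y∈T) here (λ ())
  ... | _ , here refl , 1+y∈⊥ , _ = ∉⊥ 1+y∈⊥
  ... | _ , there G∈ , _ , 0∉G with ∈-map⁻ (true ∷_) G∈
  ...   | _ , _ , refl = 0∉G here

∈-++ˡ⁺ : ∀ {m n} (p : Subset m) (q : Subset n) {x} → x ∈ p → x ↑ˡ n ∈ p Vec.++ q
∈-++ˡ⁺ (_ ∷ p) q here = here
∈-++ˡ⁺ (_ ∷ p) q (there x∈p) = there (∈-++ˡ⁺ p q x∈p)

∈-++ˡ⁻ : ∀ {m n} (p : Subset m) (q : Subset n) x → x ↑ˡ n ∈ p Vec.++ q → x ∈ p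
∈-++ˡ⁻ (_ ∷ p) q zero here = here
∈-++ˡ⁻ (_ ∷ p) q (suc x) (there x∈) = there (∈-++ˡ⁻ p q x x∈)

∈-++ʳ⁺ : ∀ {m n} (p : Subset m) (q : Subset n) {y} → y ∈ q → m ↑ʳ y ∈ p Vec.++ q
∈-++ʳ⁺ [] q y∈q = y∈q
∈-++ʳ⁺ (_ ∷ p) q y∈q = there (∈-++ʳ⁺ p q y∈q)

∈-++ʳ⁻ : ∀ {m n} (p : Subset m) (q : Subset n) y → m ↑ʳ y ∈ p Vec.++ q → y ∈ q
∈-++ʳ⁻ [] q y y∈ = y∈
∈-++ʳ⁻ (_ ∷ p) q y (there y∈) = ∈-++ʳ⁻ p q y y∈

∣p++q∣≡∣p∣+∣q∣ : ∀ {m n} (p : Subset m) (q : Subset n) → ∣ p Vec.++ q ∣ ≡ ∣ p ∣ + ∣ q ∣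
∣p++q∣≡∣p∣+∣q∣ [] q = refl
∣p++q∣≡∣p∣+∣q∣ (true ∷ p) q = cong suc (∣p++q∣≡∣p∣+∣q∣ p q)
∣p++q∣≡∣p∣+∣q∣ (false ∷ p) q = ∣p++q∣≡∣p∣+∣q∣ p q

_⊗_ : ∀ {m n} → List (Subset m) → List (Subset n) → List (Subset (m + n))
𝓐 ⊗ 𝓑 = cartesianProductWith Vec._++_ 𝓐 𝓑

separates-⊗ˡ : ∀ {m n} (𝓐 : List (Subset m)) (𝓑 : List (Subset n)) {T₁ T₂} →
  Separates (𝓐 ⊗ 𝓑) (T₁ Vec.++ T₂) → Separates 𝓐 T₁
separates-⊗ˡ {n = n} 𝓐 𝓑 {T₁} {T₂} sep x y x∈T₁ y∈T₁ x≢y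
  with sep (x ↑ˡ n) (y ↑ˡ n) (∈-++ˡ⁺ T₁ T₂ x∈T₁) (∈-++ˡ⁺ T₁ T₂ y∈T₁) (x≢y ∘ ↑ˡ-injective n x y)
... | _ , G∈ , x∈G , y∉G with ∈-cartesianProductWith⁻ Vec._++_ 𝓐 𝓑 G∈
...   | A , B , A∈𝓐 , _ , refl = A , A∈𝓐 , ∈-++ˡ⁻ A B x x∈G , y∉G ∘ ∈-++ˡ⁺ A B

separates-⊗ʳ : ∀ {m n} (𝓐 : List (Subset m)) (𝓑 : List (Subset n)) {T₁ T₂} →
  Separates (𝓐 ⊗ 𝓑) (T₁ Vec.++ T₂) → Separates 𝓑 T₂
separates-⊗ʳ {m} 𝓐 𝓑 {T₁} {T₂} sep x y x∈T₂ y∈T₂ x≢y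
  with sep (m ↑ʳ x) (m ↑ʳ y) (∈-++ʳ⁺ T₁ T₂ x∈T₂) (∈-++ʳ⁺ T₁ T₂ y∈T₂) (x≢y ∘ ↑ʳ-injective m x y)
... | _ , G∈ , x∈G , y∉G with ∈-cartesianProductWith⁻ Vec._++_ 𝓐 𝓑 G∈
...   | A , B , _ , B∈𝓑 , refl = B , B∈𝓑 , ∈-++ʳ⁻ A B x x∈G , y∉G ∘ ∈-++ʳ⁺ A B

length-⊗ : ∀ {m n} (𝓐 : List (Subset m)) (𝓑 : List (Subset n)) → length (𝓐 ⊗ 𝓑) ≡ length 𝓐 * length 𝓑
length-⊗ [] 𝓑 = refl
length-⊗ (A ∷ 𝓐) 𝓑 =
  trans (length-++ (map (A Vec.++_) 𝓑)) (cong₂ _+_ (length-map (A Vec.++_) 𝓑) (length-⊗ 𝓐 𝓑))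

-- The sets of blockFamily (a₁ ∷ … ∷ aₖ) are the unions of one initial segment of each
-- block of a partition of Fin (a₁ + … + aₖ) into consecutive blocks of sizes aᵢ.
blockFamily : (as : List ℕ) → List (Subset (sum as))
blockFamily [] = [] ∷ []
blockFamily (a ∷ as) = initialSegments a ⊗ blockFamily as

length-blockFamily : ∀ as → length (blockFamily as) ≡ product (map suc as)
length-blockFamily [] = refl
length-blockFamily (a ∷ as) =
  trans (length-⊗ (initialSegments a) (blockFamily as))
        (cong₂ _*_ (length-initialSegments a) (length-blockFamily as))

unique-blockFamily : ∀ as → Unique (blockFamily as)
unique-blockFamily [] = [] ∷ []
unique-blockFamily (a ∷ as) = Uniqueₚ.cartesianProductWith⁺ Vec._++_ (λ {A} {A′} → ++-injective A A′)
  (unique-initialSegments a) (unique-blockFamily as)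

separates-blockFamily : ∀ as (T : Subset (sum as)) → Separates (blockFamily as) T → ∣ T ∣ ≤ length as
separates-blockFamily [] [] _ = z≤n
separates-blockFamily (a ∷ as) T sep with splitAt a T
... | T₁ , T₂ , refl = begin
  ∣ T₁ Vec.++ T₂ ∣     ≡⟨ ∣p++q∣≡∣p∣+∣q∣ T₁ T₂ ⟩
  ∣ T₁ ∣ + ∣ T₂ ∣      ≤⟨ +-mono-≤ (separates-initialSegments a T₁ (separates-⊗ˡ 𝓐 𝓑 sep))
                                   (separates-blockFamily as T₂ (separates-⊗ʳ 𝓐 𝓑 sep)) ⟩
  1 + length as        ∎
  where
  open ≤-Reasoning
  𝓐 : List (Subset a)
  𝓐 = initialSegments a
  𝓑 : List (Subset (sum as))
  𝓑 = blockFamily as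

sum-replicate : ∀ j q → sum (replicate j q) ≡ j * q
sum-replicate zero q = refl
sum-replicate (suc j) q = cong (q +_) (sum-replicate j q)

-- Parts of size ⌊n/(j+1)⌋, the first one enlarged by the remainder.
balancedPartition : ∀ n j → ∃ λ as → sum as ≡ n × length as ≡ suc j × All (λ a → n ≤ suc j * suc a) as
balancedPartition n j =
  n ∸ j * q ∷ replicate j q ,
  trans (cong (n ∸ j * q +_) (sum-replicate j q)) (m∸n+n≡m (≤-trans (m≤n+m (j * q) q) K*q≤n)) ,
  cong suc (length-replicate j) ,
  ≤-trans n≤K*[1+q] (*-monoʳ-≤ K (s≤s (m+n≤o⇒m≤o∸n q K*q≤n))) ∷ replicate⁺ j n≤K*[1+q]
  where
  K q : ℕ
  K = suc j
  q = n / K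
  K*q≤n : K * q ≤ n
  K*q≤n = subst (_≤ n) (*-comm q K) (m/n*n≤m n K)
  n≤K*[1+q] : n ≤ K * suc q
  n≤K*[1+q] = begin
    n                ≡⟨ m≡m%n+[m/n]*n n K ⟩
    n % K + q * K    ≤⟨ +-monoˡ-≤ (q * K) (<⇒≤ (m%n<n n K)) ⟩
    K + q * K        ≡⟨ cong (K +_) (*-comm q K) ⟩
    K + K * q        ≡⟨ *-suc K q ⟨
    K * suc q        ∎
    where open ≤-Reasoning

^≤product*^ : ∀ n K (as : List ℕ) → All (λ a → n ≤ K * suc a) as →
  n ^ length as ≤ product (map suc as) * K ^ length as
^≤product*^ n K [] [] = ≤-refl
^≤product*^ n K (a ∷ as) (n≤K*[1+a] ∷ balanced) = begin
  n * n ^ length as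
    ≤⟨ *-mono-≤ n≤K*[1+a] (^≤product*^ n K as balanced) ⟩
  (K * suc a) * (product (map suc as) * K ^ length as)
    ≡⟨ solve 4 (λ k b p x → (k :* b) :* (p :* x) := (b :* p) :* (k :* x)) refl
         K (suc a) (product (map suc as)) (K ^ length as) ⟩
  (suc a * product (map suc as)) * (K * K ^ length as)
    ∎
  where
  open ≤-Reasoning
  open +-*-Solver

nonSeparable⇒size<s : ∀ {n t s} → IsS n t s → (𝓕 : Family n) → ¬ Separable t 𝓕 → size 𝓕 < s
nonSeparable⇒size<s {s = s} isS 𝓕 ¬separable with s ≤? size 𝓕
... | yes s≤size = ⊥-elim (¬separable (proj₁ isS 𝓕 s≤size))
... | no s≰size = ≰⇒> s≰size

product<s : ∀ {n K s} → IsS n (suc K) s → (as : List ℕ) → sum as ≡ n → length as ≡ K →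
  product (map suc as) < s
product<s isS as refl refl =
  subst (_< _) (length-blockFamily as)
    (nonSeparable⇒size<s isS (family (blockFamily as) (unique-blockFamily as))
      λ (T , ∣T∣≡1+K , sep) → 1+n≰n (subst (_≤ length as) ∣T∣≡1+K (separates-blockFamily as T sep)))

n^K<s*K^K : ∀ {n j s} → IsS n (suc (suc j)) s → n ^ suc j < s * suc j ^ suc j
n^K<s*K^K {n} {j} {s} isS with balancedPartition n j
... | as , ∑as≡n , ∣as∣≡1+j , balanced = begin-strict
  n ^ suc j                                    ≡⟨ cong (n ^_) ∣as∣≡1+j ⟨
  n ^ length as                                ≤⟨ ^≤product*^ n (suc j) as balanced ⟩
  product (map suc as) * suc j ^ length as     ≡⟨ cong ((product (map suc as) *_) ∘ (suc j ^_)) ∣as∣≡1+j ⟩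
  product (map suc as) * suc j ^ suc j
    <⟨ *-monoˡ-< (suc j ^ suc j) {{m^n≢0 (suc j) (suc j)}} (product<s isS as ∑as≡n ∣as∣≡1+j) ⟩
  s * suc j ^ suc j                            ∎
  where open ≤-Reasoning

theorem6 : ∀ (n t : ℕ) → 4 ≤ t → t ≤ n →
    ∀ (s g : ℕ) → IsS n t s → IsG n (t ∸ 1) g →
    (n ^ (t ∸ 1) < s * (t ∸ 1) ^ (t ∸ 1)) × (s ≤ g + 1 + binomSum n (t ∸ 1))
-- Both bounds hold as soon as t ≥ 2.
theorem6 n (suc (suc t)) (s≤s (s≤s _)) _ s g isS isG =
  n^K<s*K^K isS , proj₂ isS _ (λ 𝓕 → large⇒separable isG 𝓕)
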